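{- Let $P_n$ be a path of order $n\ge 2$. Then $\xi(P_n\square P_n)=\left\lceil \frac{n^2}{2}\right\rceil$.
   Context: All graphs are finite, simple, connected and undirected; $d_G(u,v)$ is the shortest-path distance. A set $D\subseteq V(G)$ is a distance-equalizer set of $G$ if for any two vertices $x,y\in V(G)\setminus D$ there is $w\in D$ with $d_G(x,w)=d_G(y,w)$. The equidistant dimension $\xi(G)$ is the minimum cardinality of a distance-equalizer set of $G$. $P_n$ is the path on $n$ vertices. The Cartesian product $G\square H$ has vertex set $V(G)\times V(H)$, with $(g,h)\sim(g',h')$ iff either $g=g'$ and $hh'\in E(H)$, or $h=h'$ and $gg'\in E(G)$. -}

module Defs where

open import Level using (0ℓ)
open import Data.Nat using (ℕ; zero; suc; _≤_)
open import Data.Fin using (Fin; toℕ)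
open import Data.Product using (_×_; _,_; ∃-syntax)
open import Data.Sum using (_⊎_)
open import Data.List using (List; length)
open import Data.List.Membership.Propositional using (_∈_; _∉_)
open import Data.List.Relation.Unary.Unique.Propositional using (Unique)
open import Relation.Binary.PropositionalEquality using (_≡_)

record Graph : Set₁ where
  field
    V   : Set
    Adj : V → V → Set
open Graph public

data Walk (G : Graph) : V G → V G → ℕ → Set where
  here : ∀ {x} → Walk G x x zero
  step : ∀ {x y z k} → Adj G x y → Walk G y z k → Walk G x z (suc k)

Dist : (G : Graph) → V G → V G → ℕ → Set
Dist G x y k = Walk G x y k × (∀ j → Walk G x y j → k ≤ j)

Path : ℕ → Graph
Path n = record
  { V   = Fin n
  ; Adj = λ i j → (suc (toℕ i) ≡ toℕ j) ⊎ (suc (toℕ j) ≡ toℕ i) }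

_□_ : Graph → Graph → Graph
G □ H = record
  { V   = V G × V H
  ; Adj = λ { (g , h) (g' , h') → (g ≡ g' × Adj H h h') ⊎ (h ≡ h' × Adj G g g') } }

IsDistanceEqualizer : (G : Graph) → List (V G) → Set
IsDistanceEqualizer G D =
  ∀ x y → x ∉ D → y ∉ D →
    ∃[ w ] (w ∈ D × ∃[ k ] (Dist G x w k × Dist G y w k))

EquidistantDimension : (G : Graph) → ℕ → Set
EquidistantDimension G m =
  (∃[ D ] (Unique D × IsDistanceEqualizer G D × length D ≡ m))
  × (∀ D → Unique D → IsDistanceEqualizer G D → m ≤ length D)

-- Colour the vertex (i , j) of P_n □ P_n by the parity of i + j. Distances in the
-- grid are ℓ₁-distances, whose parity is the sum of the colours of the two ends, so all
-- vertices outside a distance-equalizer D share one colour. Pairing 2k with 2k + 1 in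
-- the second coordinate (in the first one when the second is the unpaired n - 1) is a
-- colour-reversing involution whose only possible fixed point is the corner
-- (n - 1 , n - 1). Paired vertices cannot both lie outside D, so n² ≤ 2|D|; a fixed
-- corner outside D forces an even vertex into D, which makes up for it.
-- Conversely the even vertices form an equalizer: for odd x = (a , b) and y = (c , d)
-- with |b - d| ≤ |a - c|, the points of one column above max b d, and of another column
-- below min b d, are all equidistant from x and y; two adjacent points of such a ray
-- have different colours, and when both rays are single points x and y are the corners
-- (0 , n - 1) and (n - 1 , 0), equidistant from (0 , 0).

module Submission where

open import Defs
open import Algebra.Bundles using (CommutativeRing)
open import Data.Bool using (Bool; true; false; not; _xor_)
import Data.Bool as Bool
open import Data.Bool.Properties
  using ( not-involutive; not-distribˡ-xor; not-distribʳ-xor; xor-same; xor-identityʳ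
        ; xor-annihilates-not; xor-∧-commutativeRing; not-¬; ¬-not)
open import Data.Empty using (⊥-elim)
open import Data.Fin using (Fin; zero; suc; toℕ; fromℕ; fromℕ<)
open import Data.Fin.Properties using (toℕ-fromℕ; toℕ-fromℕ<)
import Data.Fin.Properties as Fin
open import Data.List using (List; []; _∷_; _++_; map; filter; length; allFin; cartesianProduct)
open import Data.List.Membership.Propositional using (_∈_; _∉_)
open import Data.List.Membership.Propositional.Properties
  using ( ∈-∃++; ∈-++⁻; ∈-++⁺ˡ; ∈-++⁺ʳ; ∈-map⁺; ∈-filter⁺; ∈-filter⁻; ∈-allFin
        ; ∈-cartesianProduct⁺)
open import Data.List.Properties using (length-++; length-map; length-tabulate)
open import Data.List.Relation.Unary.All using (lookup)
open import Data.List.Relation.Unary.AllPairs using (_∷_)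
open import Data.List.Relation.Unary.Any using (here; there)
open import Data.List.Relation.Unary.Unique.Propositional using (Unique)
import Data.List.Relation.Unary.Unique.Propositional.Properties as Unique
open import Data.Nat
  using (ℕ; zero; suc; _+_; _*_; _≤_; _<_; _⊔_; _⊓_; ∣_-_∣; z≤n; s≤s; s≤s⁻¹; _<?_; ⌈_/2⌉; ⌊_/2⌋)
open import Data.Nat.Properties hiding (_≟_)
open import Data.Nat.Tactic.RingSolver using (solve)
open import Data.Product using (_×_; _,_; proj₁; proj₂; ∃-syntax; ∃₂)
import Data.Product.Properties as Product
open import Data.Sum using (_⊎_; inj₁; inj₂)
import Data.Sum as Sum
open import Function using (_∘_; id)
open import Level using (0ℓ)
open import Relation.Binary.PropositionalEquality
open import Relation.Nullary using (yes; no; Dec; contradiction)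
open import Relation.Unary using (Pred; Decidable)
open import Relation.Unary.Properties using (∁?)

open import Algebra.Properties.CommutativeSemigroup +-commutativeSemigroup
  using () renaming (interchange to +-interchange)
open import Algebra.Properties.CommutativeSemigroup
  (CommutativeRing.+-commutativeSemigroup xor-∧-commutativeRing)
  using () renaming (interchange to xor-interchange)
open import Algebra.Properties.Group (CommutativeRing.+-group xor-∧-commutativeRing)
  using () renaming (∙-cancelʳ to xor-cancelʳ)

odd : ℕ → Bool
odd zero    = false
odd (suc n) = not (odd n)

odd-+ : ∀ m n → odd (m + n) ≡ odd m xor odd n
odd-+ zero    n = refl
odd-+ (suc m) n = trans (cong not (odd-+ m n)) (not-distribˡ-xor (odd m) (odd n))

odd-double : ∀ n → odd (n + n) ≡ false
odd-double n = trans (odd-+ n n) (xor-same (odd n))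

odd-∣-∣ : ∀ m n → odd ∣ m - n ∣ ≡ odd m xor odd n
odd-∣-∣ zero    n       = refl
odd-∣-∣ (suc m) zero    = sym (xor-identityʳ _)
odd-∣-∣ (suc m) (suc n) = trans (odd-∣-∣ m n) (sym (xor-annihilates-not (odd m) (odd n)))

odd-ℓ₁ : ∀ a b c d → odd (∣ a - c ∣ + ∣ b - d ∣) ≡ odd (a + b) xor odd (c + d)
odd-ℓ₁ a b c d = begin
  odd (∣ a - c ∣ + ∣ b - d ∣)                 ≡⟨ odd-+ ∣ a - c ∣ ∣ b - d ∣ ⟩
  odd ∣ a - c ∣ xor odd ∣ b - d ∣             ≡⟨ cong₂ _xor_ (odd-∣-∣ a c) (odd-∣-∣ b d) ⟩
  (odd a xor odd c) xor (odd b xor odd d)   ≡⟨ xor-interchange (odd a) (odd c) (odd b) (odd d) ⟩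
  (odd a xor odd b) xor (odd c xor odd d)   ≡⟨ sym (cong₂ _xor_ (odd-+ a b) (odd-+ c d)) ⟩
  odd (a + b) xor odd (c + d)               ∎
  where open ≡-Reasoning

even⇒double : ∀ n → odd n ≡ false → ∃[ r ] n ≡ r + r
even⇒double zero          _    = 0 , refl
even⇒double (suc zero)    ()
even⇒double (suc (suc n)) even with even⇒double n (trans (sym (not-involutive (odd n))) even)
... | r , refl = suc r , cong suc (sym (+-suc r r))

even-gap : ∀ {p q} → q ≤ p → odd (p + q) ≡ false → ∃[ r ] p ≡ q + (r + r)
even-gap {q = q} q≤p even with m≤n⇒∃[o]m+o≡n q≤p
... | k , refl with even⇒double k k-even
  where
  open ≡-Reasoning
  k-even : odd k ≡ false
  k-even = begin
    odd k                   ≡⟨ sym (xor-identityʳ (odd k)) ⟩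
    odd k xor false         ≡⟨ cong (odd k xor_) (sym (odd-double q)) ⟩
    odd k xor odd (q + q)   ≡⟨ sym (odd-+ k (q + q)) ⟩
    odd (k + (q + q))       ≡⟨ cong odd (trans (sym (+-assoc k q q)) (cong (_+ q) (+-comm k q))) ⟩
    odd (q + k + q)         ≡⟨ even ⟩
    false                   ∎
... | r , refl = r , refl

∣m-n∣+m≡n : ∀ {m n} → m ≤ n → ∣ m - n ∣ + m ≡ n
∣m-n∣+m≡n {m} m≤n = trans (cong (_+ m) (m≤n⇒∣m-n∣≡n∸m m≤n)) (m∸n+n≡m m≤n)

∣m+n-m∣≡n : ∀ m n → ∣ m + n - m ∣ ≡ n
∣m+n-m∣≡n m n = trans (∣-∣-comm (m + n) m) (∣m-m+n∣≡n m n)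

cross-cancel : ∀ A B C D {x y} → A + y ≡ C + x → B + x ≡ D + y → A + B ≡ C + D
cross-cancel A B C D {x} {y} e e′ = +-cancelʳ-≡ (x + y) (A + B) (C + D) (begin
  A + B + (x + y)       ≡⟨ solve (A ∷ B ∷ x ∷ y ∷ []) ⟩
  (A + y) + (B + x)     ≡⟨ cong₂ _+_ e e′ ⟩
  (C + x) + (D + y)     ≡⟨ solve (C ∷ D ∷ x ∷ y ∷ []) ⟩
  C + D + (x + y)       ∎)
  where open ≡-Reasoning

∣-∣-above : ∀ {b d s} → b ⊔ d ≤ s → ∣ b - s ∣ + b ≡ ∣ d - s ∣ + d
∣-∣-above {b} {d} le =
  trans (∣m-n∣+m≡n (≤-trans (m≤m⊔n b d) le)) (sym (∣m-n∣+m≡n (≤-trans (m≤n⊔m b d) le)))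

∣-∣-below : ∀ {b d s} → s ≤ b ⊓ d → ∣ b - s ∣ + d ≡ ∣ d - s ∣ + b
∣-∣-below {b} {d} {s} le
  with m≤n⇒∃[o]m+o≡n (≤-trans le (m⊓n≤m b d)) | m≤n⇒∃[o]m+o≡n (≤-trans le (m⊓n≤n b d))
... | u , refl | v , refl = begin
  ∣ s + u - s ∣ + (s + v) ≡⟨ cong (_+ (s + v)) (∣m+n-m∣≡n s u) ⟩
  u + (s + v)             ≡⟨ solve (u ∷ v ∷ s ∷ []) ⟩
  v + (s + u)             ≡⟨ cong (_+ (s + u)) (sym (∣m+n-m∣≡n s v)) ⟩
  ∣ s + v - s ∣ + (s + u) ∎
  where open ≡-Reasoning

extremes : ∀ {L m n} → m ≤ L → n ≤ L → L ≤ ∣ m - n ∣ → (m ≡ 0 × n ≡ L) ⊎ (m ≡ L × n ≡ 0)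
extremes {m = zero}          _   n≤L L≤n = inj₁ (refl , ≤-antisym n≤L L≤n)
extremes {m = suc m} {zero}  m≤L _   L≤m = inj₂ (≤-antisym m≤L L≤m , refl)
extremes {m = suc m} {suc n} m<L n<L L≤  =
  ⊥-elim (≤⇒≯ (≤-trans L≤ (∣m-n∣≤m⊔n m n)) (⊔-pres-<m m<L n<L))

⊓⊔-extremes : ∀ {L m n} → m ⊓ n ≡ 0 → m ⊔ n ≡ L → (m ≡ 0 × n ≡ L) ⊎ (m ≡ L × n ≡ 0)
⊓⊔-extremes {m = zero}         _ refl = inj₁ (refl , refl)
⊓⊔-extremes {m = suc m} {zero} _ refl = inj₂ (refl , refl)

anti-diagonal : ∀ {L t s} → t ≤ L → s ≤ L → t + s ≡ ∣ L - t ∣ + ∣ L - s ∣ → t + s ≡ L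
anti-diagonal {L} {t} {s} t≤L s≤L e = begin
  t + s                     ≡⟨ n≡⌊n+n/2⌋ (t + s) ⟩
  ⌊ (t + s) + (t + s) /2⌋   ≡⟨ cong ⌊_/2⌋ doubled ⟩
  ⌊ L + L /2⌋               ≡⟨ sym (n≡⌊n+n/2⌋ L) ⟩
  L                         ∎
  where
  open ≡-Reasoning
  m+∣L-m∣≡L : ∀ {m} → m ≤ L → m + ∣ L - m ∣ ≡ L
  m+∣L-m∣≡L {m} m≤L = trans (cong (m +_) (m≤n⇒∣n-m∣≡n∸m m≤L)) (m+[n∸m]≡n m≤L)
  doubled : (t + s) + (t + s) ≡ L + L
  doubled = begin
    (t + s) + (t + s)                   ≡⟨ cong ((t + s) +_) e ⟩
    (t + s) + (∣ L - t ∣ + ∣ L - s ∣)     ≡⟨ +-interchange t s ∣ L - t ∣ ∣ L - s ∣ ⟩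
    (t + ∣ L - t ∣) + (s + ∣ L - s ∣)     ≡⟨ cong₂ _+_ (m+∣L-m∣≡L t≤L) (m+∣L-m∣≡L s≤L) ⟩
    L + L                               ∎

m+m≤1+n⇒m≤⌈n/2⌉ : ∀ {m n} → m + m ≤ suc n → m ≤ ⌈ n /2⌉
m+m≤1+n⇒m≤⌈n/2⌉ {m} le = subst (_≤ _) (sym (n≡⌊n+n/2⌋ m)) (⌊n/2⌋-mono le)

n≤m+m⇒⌈n/2⌉≤m : ∀ {m n} → n ≤ m + m → ⌈ n /2⌉ ≤ m
n≤m+m⇒⌈n/2⌉≤m {m} le = subst (_ ≤_) (sym (n≡⌈n+n/2⌉ m)) (⌈n/2⌉-mono le)

Unique-⊆⇒length≤ : ∀ {A : Set} {xs ys : List A} → Unique xs → (∀ {x} → x ∈ xs → x ∈ ys) →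
                   length xs ≤ length ys
Unique-⊆⇒length≤ {xs = []}     _                 _  = z≤n
Unique-⊆⇒length≤ {xs = x ∷ xs} (x∉xs ∷ unique) xs⊆ys with ∈-∃++ (xs⊆ys (here refl))
... | ys₁ , ys₂ , refl = begin
  suc (length xs)               ≤⟨ s≤s (Unique-⊆⇒length≤ unique xs⊆ys₁++ys₂) ⟩
  suc (length (ys₁ ++ ys₂))     ≡⟨ cong suc (length-++ ys₁) ⟩
  suc (length ys₁ + length ys₂) ≡⟨ sym (+-suc (length ys₁) (length ys₂)) ⟩
  length ys₁ + suc (length ys₂) ≡⟨ sym (length-++ ys₁) ⟩
  length (ys₁ ++ x ∷ ys₂)       ∎
  where
  open ≤-Reasoning
  xs⊆ys₁++ys₂ : ∀ {y} → y ∈ xs → y ∈ ys₁ ++ ys₂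
  xs⊆ys₁++ys₂ y∈xs with ∈-++⁻ ys₁ (xs⊆ys (there y∈xs))
  ... | inj₁ y∈ys₁         = ∈-++⁺ˡ y∈ys₁
  ... | inj₂ (here refl)   = ⊥-elim (lookup x∉xs y∈xs refl)
  ... | inj₂ (there y∈ys₂) = ∈-++⁺ʳ ys₁ y∈ys₂

length-filter-∁ : ∀ {A : Set} {P : Pred A 0ℓ} (P? : Decidable P) xs →
                  length (filter P? xs) + length (filter (∁? P?) xs) ≡ length xs
length-filter-∁ P? []       = refl
length-filter-∁ P? (x ∷ xs) with P? x
... | yes _ = cong suc (length-filter-∁ P? xs)
... | no  _ = trans (+-suc _ _) (cong suc (length-filter-∁ P? xs))

length-cartesianProduct : ∀ {A B : Set} (xs : List A) (ys : List B) →
                          length (cartesianProduct xs ys) ≡ length xs * length ys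
length-cartesianProduct []       ys = refl
length-cartesianProduct (x ∷ xs) ys = trans (length-++ (map (x ,_) ys))
  (cong₂ _+_ (length-map (x ,_) ys) (length-cartesianProduct xs ys))

Walk-map : ∀ {G H : Graph} (f : V G → V H) → (∀ {x y} → Adj G x y → Adj H (f x) (f y)) →
           ∀ {x y k} → Walk G x y k → Walk H (f x) (f y) k
Walk-map f hom here       = here
Walk-map f hom (step a w) = step (hom a) (Walk-map f hom w)

Walk-++ : ∀ {G x y z k l} → Walk G x y k → Walk G y z l → Walk G x z (k + l)
Walk-++ here       w′ = w′
Walk-++ (step a w) w′ = step a (Walk-++ w w′)

Walk-snoc : ∀ {G x y z k} → Walk G x y k → Adj G y z → Walk G x z (suc k)
Walk-snoc here       a′ = step a′ here
Walk-snoc (step a w) a′ = step a (Walk-snoc w a′)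

Walk-reverse : ∀ {G} → (∀ {x y} → Adj G x y → Adj G y x) → ∀ {x y k} → Walk G x y k → Walk G y x k
Walk-reverse sym-adj here       = here
Walk-reverse sym-adj (step a w) = Walk-snoc (Walk-reverse sym-adj w) (sym-adj a)

Walk-□-split : ∀ {G H g g′ h h′ k} → Walk (G □ H) (g , h) (g′ , h′) k →
               ∃₂ λ k₁ k₂ → Walk G g g′ k₁ × Walk H h h′ k₂ × k₁ + k₂ ≡ k
Walk-□-split here = 0 , 0 , here , here , refl
Walk-□-split (step (inj₁ (refl , a)) w) with Walk-□-split w
... | k₁ , k₂ , w₁ , w₂ , refl = k₁ , suc k₂ , w₁ , step a w₂ , +-suc k₁ k₂
Walk-□-split (step (inj₂ (refl , a)) w) with Walk-□-split w
... | k₁ , k₂ , w₁ , w₂ , refl = suc k₁ , k₂ , step a w₁ , w₂ , refl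

Walk-□-join : ∀ {G H g g′ h h′ k₁ k₂} → Walk G g g′ k₁ → Walk H h h′ k₂ →
              Walk (G □ H) (g , h) (g′ , h′) (k₁ + k₂)
Walk-□-join {g′ = g′} {h = h} w₁ w₂ =
  Walk-++ (Walk-map (_, h) (λ a → inj₂ (refl , a)) w₁) (Walk-map (g′ ,_) (λ a → inj₁ (refl , a)) w₂)

∣-∣≡1 : ∀ {m n} → suc m ≡ n ⊎ suc n ≡ m → ∣ m - n ∣ ≡ 1
∣-∣≡1 {m}     (inj₁ refl) = trans (m≤n⇒∣m-n∣≡n∸m (n≤1+n m)) (m+n∸n≡m 1 m)
∣-∣≡1 {n = n} (inj₂ refl) = trans (∣-∣-comm (suc n) n) (∣-∣≡1 {n} (inj₁ refl))

∣-∣≤length : ∀ {n} {i j : Fin n} {k} → Walk (Path n) i j k → ∣ toℕ i - toℕ j ∣ ≤ k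
∣-∣≤length {i = i} here = ≤-reflexive (∣n-n∣≡0 (toℕ i))
∣-∣≤length {i = i} {j} (step {y = i′} a w) = begin
  ∣ toℕ i - toℕ j ∣                       ≤⟨ ∣-∣-triangle (toℕ i) (toℕ i′) (toℕ j) ⟩
  ∣ toℕ i - toℕ i′ ∣ + ∣ toℕ i′ - toℕ j ∣ ≡⟨ cong (_+ ∣ toℕ i′ - toℕ j ∣) (∣-∣≡1 a) ⟩
  suc ∣ toℕ i′ - toℕ j ∣                  ≤⟨ s≤s (∣-∣≤length w) ⟩
  suc _                                   ∎
  where open ≤-Reasoning

Walk-Path-suc : ∀ {n} {i j : Fin n} {k} → Walk (Path n) i j k → Walk (Path (suc n)) (suc i) (suc j) k
Walk-Path-suc = Walk-map suc (Sum.map (cong suc) (cong suc))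

walk-from-zero : ∀ {n} (j : Fin (suc n)) → Walk (Path (suc n)) zero j (toℕ j)
walk-from-zero         zero    = here
walk-from-zero {suc n} (suc j) = step (inj₁ refl) (Walk-Path-suc (walk-from-zero j))

walk-Path : ∀ {n} (i j : Fin n) → Walk (Path n) i j ∣ toℕ i - toℕ j ∣
walk-Path zero    j       = walk-from-zero j
walk-Path (suc i) zero    = Walk-reverse Sum.swap (walk-from-zero (suc i))
walk-Path (suc i) (suc j) = Walk-Path-suc (walk-Path i j)

-- An even point equidistant from two odd points of a square grid

balance-↗ : ∀ a b q r →
            ∃[ t ] t ≤ a + (q + (r + r)) × ∣ a - t ∣ + (b + q) ≡ ∣ a + (q + (r + r)) - t ∣ + b
balance-↗ a b q r = a + r , +-monoʳ-≤ a (≤-trans (m≤m+n r r) (m≤n+m (r + r) q)) , (begin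
  ∣ a - a + r ∣ + (b + q)            ≡⟨ cong (_+ (b + q)) (∣m-m+n∣≡n a r) ⟩
  r + (b + q)                        ≡⟨ solve (r ∷ b ∷ q ∷ []) ⟩
  (q + r) + b                        ≡⟨ cong (_+ b) (sym (∣m+n-m∣≡n (a + r) (q + r))) ⟩
  ∣ a + r + (q + r) - a + r ∣ + b     ≡⟨ cong (λ c → ∣ c - a + r ∣ + b) regroup ⟩
  ∣ a + (q + (r + r)) - a + r ∣ + b   ∎)
  where
  open ≡-Reasoning
  regroup : a + r + (q + r) ≡ a + (q + (r + r))
  regroup = solve (a ∷ q ∷ r ∷ [])

balance-↘ : ∀ a d q r →
            ∃[ t ] t ≤ a + (q + (r + r)) × ∣ a - t ∣ + d ≡ ∣ a + (q + (r + r)) - t ∣ + (d + q)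
balance-↘ a d q r = a + (q + r) , +-monoʳ-≤ a (+-monoʳ-≤ q (m≤n+m r r)) , (begin
  ∣ a - a + (q + r) ∣ + d                       ≡⟨ cong (_+ d) (∣m-m+n∣≡n a (q + r)) ⟩
  (q + r) + d                                   ≡⟨ solve (q ∷ r ∷ d ∷ []) ⟩
  r + (d + q)                                   ≡⟨ cong (_+ (d + q)) (sym (∣m+n-m∣≡n (a + (q + r)) r)) ⟩
  ∣ a + (q + r) + r - a + (q + r) ∣ + (d + q)     ≡⟨ cong (λ c → ∣ c - a + (q + r) ∣ + (d + q)) regroup ⟩
  ∣ a + (q + (r + r)) - a + (q + r) ∣ + (d + q)   ∎)
  where
  open ≡-Reasoning
  regroup : a + (q + r) + r ≡ a + (q + (r + r))
  regroup = solve (a ∷ q ∷ r ∷ [])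

balance-≤ : ∀ {a b c d} → a ≤ c → ∣ b - d ∣ ≤ ∣ a - c ∣ →
            odd (∣ a - c ∣ + ∣ b - d ∣) ≡ false →
            ∃[ t ] t ≤ c × ∣ a - t ∣ + d ≡ ∣ c - t ∣ + b
balance-≤ {a} {b} {c} {d} a≤c q≤p even with m≤n⇒∃[o]m+o≡n a≤c | ≤-total b d
... | p , refl | inj₁ b≤d with m≤n⇒∃[o]m+o≡n b≤d
...   | q , refl rewrite ∣m-m+n∣≡n a p | ∣m-m+n∣≡n b q with even-gap q≤p even
...     | r , refl = balance-↗ a b q r
balance-≤ {a} {b} {c} {d} a≤c q≤p even | p , refl | inj₂ d≤b with m≤n⇒∃[o]m+o≡n d≤b
...   | q , refl rewrite ∣m-m+n∣≡n a p | ∣m+n-m∣≡n d q with even-gap q≤p even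
...     | r , refl = balance-↘ a d q r

balance : ∀ a b c d → ∣ b - d ∣ ≤ ∣ a - c ∣ → odd (∣ a - c ∣ + ∣ b - d ∣) ≡ false →
          ∃[ t ] t ≤ a ⊔ c × ∣ a - t ∣ + d ≡ ∣ c - t ∣ + b
balance a b c d q≤p even with ≤-total a c
... | inj₁ a≤c with balance-≤ a≤c q≤p even
...   | t , t≤c , e = t , m≤n⇒m≤o⊔n a t≤c , e
balance a b c d q≤p even | inj₂ c≤a
  with balance-≤ c≤a (subst₂ _≤_ (∣-∣-comm b d) (∣-∣-comm a c) q≤p)
                     (subst (λ k → odd k ≡ false) (cong₂ _+_ (∣-∣-comm a c) (∣-∣-comm b d)) even)
...   | t , t≤a , e = t , m≤n⇒m≤n⊔o c t≤a , sym e

record EvenEquidistant (n a b c d : ℕ) : Set where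
  constructor even-equidistant
  field
    t s         : ℕ
    t<n         : t < n
    s<n         : s < n
    even        : odd (t + s) ≡ false
    equidistant : ∣ a - t ∣ + ∣ b - s ∣ ≡ ∣ c - t ∣ + ∣ d - s ∣

EvenEquidistant-transpose : ∀ {n a b c d} → EvenEquidistant n b a d c → EvenEquidistant n a b c d
EvenEquidistant-transpose {a = a} {b} {c} {d} (even-equidistant s t s<n t<n even equidistant) =
  even-equidistant t s t<n s<n (trans (cong odd (+-comm t s)) even)
    (trans (+-comm ∣ a - t ∣ ∣ b - s ∣) (trans equidistant (+-comm ∣ d - s ∣ ∣ c - t ∣)))

even-equidistant-of-adjacent : ∀ {n a b c d} t s → t < n → suc s < n →
                               ∣ a - t ∣ + ∣ b - s ∣ ≡ ∣ c - t ∣ + ∣ d - s ∣ →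
                               ∣ a - t ∣ + ∣ b - suc s ∣ ≡ ∣ c - t ∣ + ∣ d - suc s ∣ →
                               EvenEquidistant n a b c d
even-equidistant-of-adjacent t s t<n 1+s<n e e′ with odd (t + s) in ts
... | false = even-equidistant t s t<n (<⇒≤ 1+s<n) ts e
... | true  = even-equidistant t (suc s) t<n 1+s<n (trans (cong odd (+-suc t s)) (cong not ts)) e′

opposite-corners : ∀ {L a b c d} → a ≤ L → c ≤ L → ∣ b - d ∣ ≤ ∣ a - c ∣ →
                   b ⊓ d ≡ 0 → b ⊔ d ≡ L →
                   odd (a + b) ≡ true → odd (c + d) ≡ true → EvenEquidistant (suc L) a b c d
opposite-corners {L} a≤L c≤L q≤p ⊓≡0 ⊔≡L ox oy with ⊓⊔-extremes ⊓≡0 ⊔≡L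
... | inj₁ (refl , refl) with extremes a≤L c≤L q≤p
...   | inj₁ (refl , refl) = contradiction ox λ ()
...   | inj₂ (refl , refl) = even-equidistant 0 0 (s≤s z≤n) (s≤s z≤n) refl (+-identityʳ _)
opposite-corners {L} a≤L c≤L q≤p ⊓≡0 ⊔≡L ox oy | inj₂ (refl , refl)
  with extremes a≤L c≤L (subst (_≤ _) (∣-∣-identityʳ L) q≤p)
...   | inj₁ (refl , refl) = even-equidistant 0 0 (s≤s z≤n) (s≤s z≤n) refl (sym (+-identityʳ _))
...   | inj₂ (refl , refl) = contradiction (trans (sym ox) (odd-double L)) λ ()

even-equidistant-wide : ∀ {n a b c d} → a < n → b < n → c < n → d < n → ∣ b - d ∣ ≤ ∣ a - c ∣ →
                        odd (a + b) ≡ true → odd (c + d) ≡ true → EvenEquidistant n a b c d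
even-equidistant-wide {suc L} {a} {b} {c} {d} a<n b<n c<n d<n q≤p ox oy
  with balance a b c d q≤p gap-even
     | balance a d c b (subst (_≤ _) (∣-∣-comm b d) q≤p)
                       (subst (λ k → odd (∣ a - c ∣ + k) ≡ false) (∣-∣-comm b d) gap-even)
  where
  gap-even : odd (∣ a - c ∣ + ∣ b - d ∣) ≡ false
  gap-even = trans (odd-ℓ₁ a b c d) (cong₂ _xor_ ox oy)
... | t↑ , t↑≤ , bal↑ | t↓ , t↓≤ , bal↓ with suc (b ⊔ d) <? suc L | b ⊓ d in ⊓≡
... | yes room | _ = even-equidistant-of-adjacent t↑ (b ⊔ d) (≤-<-trans t↑≤ (⊔-pres-<m a<n c<n))
                       room (above ≤-refl) (above (n≤1+n _))
  where
  above : ∀ {s} → b ⊔ d ≤ s → ∣ a - t↑ ∣ + ∣ b - s ∣ ≡ ∣ c - t↑ ∣ + ∣ d - s ∣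
  above {s} le = cross-cancel ∣ a - t↑ ∣ ∣ b - s ∣ ∣ c - t↑ ∣ ∣ d - s ∣ bal↑ (∣-∣-above {b} {d} le)
... | no _ | suc l = even-equidistant-of-adjacent t↓ l (≤-<-trans t↓≤ (⊔-pres-<m a<n c<n))
                       (subst (_< suc L) ⊓≡ (m<n⇒m⊓o<n d b<n))
                       (below (subst (l ≤_) (sym ⊓≡) (n≤1+n l))) (below (≤-reflexive (sym ⊓≡)))
  where
  below : ∀ {s} → s ≤ b ⊓ d → ∣ a - t↓ ∣ + ∣ b - s ∣ ≡ ∣ c - t↓ ∣ + ∣ d - s ∣
  below {s} le = cross-cancel ∣ a - t↓ ∣ ∣ b - s ∣ ∣ c - t↓ ∣ ∣ d - s ∣ bal↓ (∣-∣-below {b} {d} le)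
... | no full | zero = opposite-corners (s≤s⁻¹ a<n) (s≤s⁻¹ c<n) q≤p ⊓≡
                         (≤-antisym (⊔-lub (s≤s⁻¹ b<n) (s≤s⁻¹ d<n)) (s≤s⁻¹ (≮⇒≥ full))) ox oy

odd-points-have-even-equidistant : ∀ {n a b c d} → a < n → b < n → c < n → d < n →
                                   odd (a + b) ≡ true → odd (c + d) ≡ true → EvenEquidistant n a b c d
odd-points-have-even-equidistant {a = a} {b} {c} {d} a<n b<n c<n d<n ox oy
  with ≤-total ∣ b - d ∣ ∣ a - c ∣
... | inj₁ q≤p = even-equidistant-wide a<n b<n c<n d<n q≤p ox oy
... | inj₂ p≤q = EvenEquidistant-transpose (even-equidistant-wide b<n a<n d<n c<n p≤q
                   (trans (cong odd (+-comm b a)) ox) (trans (cong odd (+-comm d c)) oy))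

partner : ∀ {n} → Fin n → Fin n
partner {suc zero}    zero          = zero
partner {suc (suc _)} zero          = suc zero
partner {suc (suc _)} (suc zero)    = zero
partner {suc (suc _)} (suc (suc i)) = suc (suc (partner i))

partner-involutive : ∀ {n} (i : Fin n) → partner (partner i) ≡ i
partner-involutive {suc zero}    zero          = refl
partner-involutive {suc (suc _)} zero          = refl
partner-involutive {suc (suc _)} (suc zero)    = refl
partner-involutive {suc (suc _)} (suc (suc i)) = cong (λ j → suc (suc j)) (partner-involutive i)

partner-flips-parity : ∀ {n} (i : Fin n) → partner i ≢ i → odd (toℕ (partner i)) ≡ not (odd (toℕ i))
partner-flips-parity {suc zero}    zero          moved = ⊥-elim (moved refl)
partner-flips-parity {suc (suc _)} zero          _     = refl
partner-flips-parity {suc (suc _)} (suc zero)    _     = refl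
partner-flips-parity {suc (suc _)} (suc (suc i)) moved =
  cong (λ b → not (not b)) (partner-flips-parity i (λ fixed → moved (cong (λ j → suc (suc j)) fixed)))

partner-fixed : ∀ {L} (i : Fin (suc L)) → partner i ≡ i → i ≡ fromℕ L × odd L ≡ false
partner-fixed {zero}        zero          _     = refl , refl
partner-fixed {suc (suc _)} (suc (suc i)) fixed with partner-fixed i (Fin.suc-injective (Fin.suc-injective fixed))
... | refl , even = refl , cong (λ b → not (not b)) even

module Grid (L : ℕ) where

  Vertex : Set
  Vertex = Fin (suc L) × Fin (suc L)

  Grid : Graph
  Grid = Path (suc L) □ Path (suc L)

  manhattan : Vertex → Vertex → ℕ
  manhattan (i , j) (k , l) = ∣ toℕ i - toℕ k ∣ + ∣ toℕ j - toℕ l ∣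

  Dist-manhattan : ∀ x y → Dist Grid x y (manhattan x y)
  Dist-manhattan (i , j) (k , l) = Walk-□-join (walk-Path i k) (walk-Path j l) , minimal
    where
    minimal : ∀ m → Walk Grid (i , j) (k , l) m → manhattan (i , j) (k , l) ≤ m
    minimal m w with Walk-□-split w
    ... | m₁ , m₂ , w₁ , w₂ , refl = +-mono-≤ (∣-∣≤length w₁) (∣-∣≤length w₂)

  Dist⇒≡manhattan : ∀ {x y k} → Dist Grid x y k → k ≡ manhattan x y
  Dist⇒≡manhattan {x} {y} (w , minimal) =
    ≤-antisym (minimal _ (proj₁ (Dist-manhattan x y))) (proj₂ (Dist-manhattan x y) _ w)

  parity : Vertex → Bool
  parity (i , j) = odd (toℕ i + toℕ j)

  equidistant⇒same-parity : ∀ x y w → manhattan x w ≡ manhattan y w → parity x ≡ parity y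
  equidistant⇒same-parity (i , j) (k , l) (t , s) e = xor-cancelʳ (parity (t , s)) _ _ (begin
    parity (i , j) xor parity (t , s)   ≡⟨ sym (odd-ℓ₁ (toℕ i) (toℕ j) (toℕ t) (toℕ s)) ⟩
    odd (manhattan (i , j) (t , s))     ≡⟨ cong odd e ⟩
    odd (manhattan (k , l) (t , s))     ≡⟨ odd-ℓ₁ (toℕ k) (toℕ l) (toℕ t) (toℕ s) ⟩
    parity (k , l) xor parity (t , s)   ∎)
    where open ≡-Reasoning

  origin corner : Vertex
  origin = zero , zero
  corner = fromℕ L , fromℕ L

  corner-even : parity corner ≡ false
  corner-even = trans (cong (λ k → odd (k + k)) (toℕ-fromℕ L)) (odd-double L)

  _≟_ : (x y : Vertex) → Dec (x ≡ y)
  _≟_ = Product.≡-dec Fin._≟_ Fin._≟_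

  open import Data.List.Membership.DecPropositional _≟_ using (_∈?_)

  pair : Vertex → Vertex
  pair (i , j) with partner j Fin.≟ j
  ... | yes _ = partner i , j
  ... | no  _ = i , partner j

  pair-involutive : ∀ x → pair (pair x) ≡ x
  pair-involutive (i , j) with partner j Fin.≟ j
  ... | yes fixed with partner j Fin.≟ j
  ...   | yes _    = cong (_, j) (partner-involutive i)
  ...   | no moved = ⊥-elim (moved fixed)
  pair-involutive (i , j) | no moved with partner (partner j) Fin.≟ partner j
  ...   | yes fixed = ⊥-elim (moved (trans (sym fixed) (partner-involutive j)))
  ...   | no _      = cong (i ,_) (partner-involutive j)

  pair-injective : ∀ {x y} → pair x ≡ pair y → x ≡ y
  pair-injective {x} {y} e = trans (sym (pair-involutive x)) (trans (cong pair e) (pair-involutive y))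

  pair-flips-parity : ∀ x → pair x ≢ x → parity (pair x) ≡ not (parity x)
  pair-flips-parity (i , j) moved with partner j Fin.≟ j
  ... | yes _ = begin
    odd (toℕ (partner i) + toℕ j)            ≡⟨ odd-+ (toℕ (partner i)) (toℕ j) ⟩
    odd (toℕ (partner i)) xor odd (toℕ j)    ≡⟨ cong (_xor odd (toℕ j)) (partner-flips-parity i moved′) ⟩
    not (odd (toℕ i)) xor odd (toℕ j)        ≡⟨ sym (not-distribˡ-xor (odd (toℕ i)) (odd (toℕ j))) ⟩
    not (odd (toℕ i) xor odd (toℕ j))        ≡⟨ cong not (sym (odd-+ (toℕ i) (toℕ j))) ⟩
    not (odd (toℕ i + toℕ j))                ∎
    where
    open ≡-Reasoning
    moved′ : partner i ≢ i
    moved′ = moved ∘ cong (_, j)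
  ... | no moved′ = begin
    odd (toℕ i + toℕ (partner j))            ≡⟨ odd-+ (toℕ i) (toℕ (partner j)) ⟩
    odd (toℕ i) xor odd (toℕ (partner j))    ≡⟨ cong (odd (toℕ i) xor_) (partner-flips-parity j moved′) ⟩
    odd (toℕ i) xor not (odd (toℕ j))        ≡⟨ sym (not-distribʳ-xor (odd (toℕ i)) (odd (toℕ j))) ⟩
    not (odd (toℕ i) xor odd (toℕ j))        ≡⟨ cong not (sym (odd-+ (toℕ i) (toℕ j))) ⟩
    not (odd (toℕ i + toℕ j))                ∎
    where open ≡-Reasoning

  pair-fixed : ∀ x → pair x ≡ x → x ≡ corner × odd L ≡ false
  pair-fixed (i , j) fx with partner j Fin.≟ j
  ... | no moved    = ⊥-elim (moved (cong proj₂ fx))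
  ... | yes fixed with partner-fixed i (cong proj₁ fx) | partner-fixed j fixed
  ...   | refl , even | refl , _ = refl , even

  vertices : List Vertex
  vertices = cartesianProduct (allFin (suc L)) (allFin (suc L))

  ∈-vertices : ∀ x → x ∈ vertices
  ∈-vertices (i , j) = ∈-cartesianProduct⁺ (∈-allFin i) (∈-allFin j)

  vertices-Unique : Unique vertices
  vertices-Unique = Unique.cartesianProduct⁺ (Unique.allFin⁺ (suc L)) (Unique.allFin⁺ (suc L))

  length-vertices : length vertices ≡ suc L * suc L
  length-vertices = trans (length-cartesianProduct (allFin (suc L)) (allFin (suc L)))
    (cong₂ _*_ (length-tabulate {n = suc L} id) (length-tabulate {n = suc L} id))

  covering-bound : ∀ D (f : Vertex → Vertex) → (∀ x → x ∈ D ++ map f D) →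
                   suc L * suc L ≤ length D + length D
  covering-bound D f covered = begin
    suc L * suc L               ≡⟨ sym length-vertices ⟩
    length vertices             ≤⟨ Unique-⊆⇒length≤ vertices-Unique (λ {x} _ → covered x) ⟩
    length (D ++ map f D)       ≡⟨ trans (length-++ D) (cong (length D +_) (length-map f D)) ⟩
    length D + length D         ∎
    where open ≤-Reasoning

  module Equalizer {D : List Vertex} (equalizer : IsDistanceEqualizer Grid D) where

    outside-same-parity : ∀ {x y} → x ∉ D → y ∉ D → parity x ≡ parity y
    outside-same-parity {x} {y} x∉D y∉D with equalizer x y x∉D y∉D
    ... | w , _ , _ , dx , dy =
      equidistant⇒same-parity x y w (trans (sym (Dist⇒≡manhattan dx)) (Dist⇒≡manhattan dy))

    pair-∉⇒fixed : ∀ {x} → x ∉ D → pair x ∉ D → pair x ≡ x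
    pair-∉⇒fixed {x} x∉D px∉D with pair x ≟ x
    ... | yes fixed = fixed
    ... | no moved  = ⊥-elim (not-¬ (outside-same-parity px∉D x∉D) (pair-flips-parity x moved))

    covered-by-pair : corner ∈ D ⊎ pair corner ≢ corner → ∀ x → x ∈ D ++ map pair D
    covered-by-pair corner-ok x with x ∈? D
    ... | yes x∈D = ∈-++⁺ˡ x∈D
    ... | no x∉D with pair x ∈? D
    ...   | yes px∈D = ∈-++⁺ʳ D (subst (_∈ map pair D) (pair-involutive x) (∈-map⁺ pair px∈D))
    ...   | no px∉D with pair-∉⇒fixed x∉D px∉D
    ...     | fixed with pair-fixed x fixed
    ...       | refl , _ = ⊥-elim (Sum.[ x∉D , (λ moved → moved fixed) ] corner-ok)

    even-in-D : corner ∉ D → odd L ≡ false → ∃[ w ] w ∈ D × parity w ≡ false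
    even-in-D c∉D L-even with origin ∈? D
    ... | yes o∈D = origin , o∈D , refl
    ... | no o∉D with equalizer origin corner o∉D c∉D
    ...   | (i , j) , w∈D , _ , d₀ , d₁ = (i , j) , w∈D , trans (cong odd on-anti-diagonal) L-even
      where
      on-anti-diagonal : toℕ i + toℕ j ≡ L
      on-anti-diagonal = anti-diagonal (s≤s⁻¹ (Fin.toℕ<n i)) (s≤s⁻¹ (Fin.toℕ<n j))
        (trans (sym (Dist⇒≡manhattan d₀)) (trans (Dist⇒≡manhattan d₁)
          (cong (λ k → ∣ k - toℕ i ∣ + ∣ k - toℕ j ∣) (toℕ-fromℕ L))))

    -- pair misses the fixed corner; since D contains both w and pair w, sending pair w
    -- to the corner instead loses no other vertex.
    module Redirect (c∉D : corner ∉ D) {w} (w∈D : w ∈ D) (w-even : parity w ≡ false) where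

      odd⇒∈D : ∀ {x} → parity x ≡ true → x ∈ D
      odd⇒∈D {x} x-odd with x ∈? D
      ... | yes x∈D = x∈D
      ... | no x∉D  =
        contradiction (trans (sym x-odd) (trans (outside-same-parity x∉D c∉D) corner-even)) λ ()

      pair-of-outside∈D : ∀ {x} → x ∉ D → x ≢ corner → pair x ∈ D
      pair-of-outside∈D {x} x∉D x≢c =
        odd⇒∈D (trans (pair-flips-parity x (x≢c ∘ proj₁ ∘ pair-fixed x))
                      (cong not (trans (outside-same-parity x∉D c∉D) corner-even)))

      pair-w∈D : pair w ∈ D
      pair-w∈D = odd⇒∈D (trans (pair-flips-parity w moved) (cong not w-even))
        where
        moved : pair w ≢ w
        moved fixed = c∉D (subst (_∈ D) (proj₁ (pair-fixed w fixed)) w∈D)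

      redirect : Vertex → Vertex
      redirect z with z ≟ pair w
      ... | yes _ = corner
      ... | no  _ = pair z

      redirect-pair-w : redirect (pair w) ≡ corner
      redirect-pair-w with pair w ≟ pair w
      ... | yes _ = refl
      ... | no ne = ⊥-elim (ne refl)

      redirect-pair : ∀ {x} → x ∉ D → redirect (pair x) ≡ x
      redirect-pair {x} x∉D with pair x ≟ pair w
      ... | yes e = ⊥-elim (x∉D (subst (_∈ D) (pair-injective (sym e)) w∈D))
      ... | no _  = pair-involutive x

      covered : ∀ x → x ∈ D ++ map redirect D
      covered x with x ∈? D
      ... | yes x∈D = ∈-++⁺ˡ x∈D
      ... | no x∉D with x ≟ corner
      ...   | yes refl = ∈-++⁺ʳ D (subst (_∈ map redirect D) redirect-pair-w (∈-map⁺ redirect pair-w∈D))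
      ...   | no x≢c   = ∈-++⁺ʳ D (subst (_∈ map redirect D) (redirect-pair x∉D)
                                    (∈-map⁺ redirect (pair-of-outside∈D x∉D x≢c)))

    lower-bound : suc L * suc L ≤ length D + length D
    lower-bound with corner ∈? D | pair corner ≟ corner
    ... | yes c∈D | _        = covering-bound D pair (covered-by-pair (inj₁ c∈D))
    ... | no _    | no moved = covering-bound D pair (covered-by-pair (inj₂ moved))
    ... | no c∉D  | yes fixed with even-in-D c∉D (proj₂ (pair-fixed corner fixed))
    ...   | w , w∈D , w-even = covering-bound D redirect covered
      where open Redirect c∉D w∈D w-even

  equalizer-length : ∀ {D} → IsDistanceEqualizer Grid D → ⌈ suc L * suc L /2⌉ ≤ length D
  equalizer-length equalizer = n≤m+m⇒⌈n/2⌉≤m (Equalizer.lower-bound equalizer)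

  even-equidistant-vertex : ∀ x y → parity x ≡ true → parity y ≡ true →
                            ∃[ w ] parity w ≡ false × manhattan x w ≡ manhattan y w
  even-equidistant-vertex (i , j) (k , l) x-odd y-odd
    with odd-points-have-even-equidistant (Fin.toℕ<n i) (Fin.toℕ<n j) (Fin.toℕ<n k) (Fin.toℕ<n l)
                                          x-odd y-odd
  ... | even-equidistant t s t<n s<n even equidistant =
    (fromℕ< t<n , fromℕ< s<n) ,
    subst₂ EvenEquidistantAt (sym (toℕ-fromℕ< t<n)) (sym (toℕ-fromℕ< s<n)) (even , equidistant)
    where
    EvenEquidistantAt : ℕ → ℕ → Set
    EvenEquidistantAt t s =
      odd (t + s) ≡ false × ∣ toℕ i - t ∣ + ∣ toℕ j - s ∣ ≡ ∣ toℕ k - t ∣ + ∣ toℕ l - s ∣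

  isEven? : Decidable (λ x → parity x ≡ false)
  isEven? x = parity x Bool.≟ false

  evens odds : List Vertex
  evens = filter isEven? vertices
  odds  = filter (∁? isEven?) vertices

  evens-Unique : Unique evens
  evens-Unique = Unique.filter⁺ isEven? vertices-Unique

  evens-equalizer : IsDistanceEqualizer Grid evens
  evens-equalizer x y x∉evens y∉evens
    with even-equidistant-vertex x y (odd-outside x∉evens) (odd-outside y∉evens)
    where
    odd-outside : ∀ {z} → z ∉ evens → parity z ≡ true
    odd-outside {z} z∉evens = ¬-not (z∉evens ∘ ∈-filter⁺ isEven? (∈-vertices z))
  ... | w , w-even , equidistant =
    w , ∈-filter⁺ isEven? (∈-vertices w) w-even ,
    manhattan x w , Dist-manhattan x w , subst (Dist Grid y w) (sym equidistant) (Dist-manhattan y w)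

  evens⊆corner∷pair-odds : ∀ {x} → x ∈ evens → x ∈ corner ∷ map pair odds
  evens⊆corner∷pair-odds {x} x∈evens with x ≟ corner
  ... | yes x≡c = here x≡c
  ... | no x≢c  = there (subst (_∈ map pair odds) (pair-involutive x)
                    (∈-map⁺ pair (∈-filter⁺ (∁? isEven?) (∈-vertices (pair x)) pair-x-odd)))
    where
    pair-x-odd : parity (pair x) ≢ false
    pair-x-odd = not-¬ (trans (pair-flips-parity x (x≢c ∘ proj₁ ∘ pair-fixed x))
                              (cong not (proj₂ (∈-filter⁻ isEven? {xs = vertices} x∈evens))))

  evens-length : length evens + length evens ≤ suc (suc L * suc L)
  evens-length = begin
    length evens + length evens       ≤⟨ +-monoʳ-≤ (length evens) evens≤1+odds ⟩
    length evens + suc (length odds)  ≡⟨ +-suc (length evens) (length odds) ⟩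
    suc (length evens + length odds)  ≡⟨ cong suc (length-filter-∁ isEven? vertices) ⟩
    suc (length vertices)             ≡⟨ cong suc length-vertices ⟩
    suc (suc L * suc L)               ∎
    where
    open ≤-Reasoning
    evens≤1+odds : length evens ≤ suc (length odds)
    evens≤1+odds = ≤-trans (Unique-⊆⇒length≤ evens-Unique evens⊆corner∷pair-odds)
                           (≤-reflexive (cong suc (length-map pair odds)))

mainTheorem4 : ∀ (n : ℕ) → 2 ≤ n →
    EquidistantDimension (Path n □ Path n) ⌈ n * n /2⌉
mainTheorem4 (suc L) _ =
  (evens , evens-Unique , evens-equalizer ,
    ≤-antisym (m+m≤1+n⇒m≤⌈n/2⌉ evens-length) (equalizer-length evens-equalizer)) ,
  λ _ _ → equalizer-length
  where open Grid L
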